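{- Let $S\subseteq\mathbb{F}_2^n$ be a Sidon set with $|S|\ge 3$. Then $S$ is maximal if and only if \[ \prod_{p\in\mathbb{F}_2^n}\ \sum_{x\in\mathbb{F}_2^n}1_S(x)\,\gamma_S(x+p)\neq 0, \] where the sums and product are computed in $\mathbb{Z}$.
   Context: A set $S\subseteq\mathbb{F}_2^n$ is Sidon if whenever $a+b=c+d$ with $a,b,c,d\in S$, $a\neq b$, $c\neq d$, then $\{a,b\}=\{c,d\}$. A Sidon set $S$ is maximal if no Sidon set in $\mathbb{F}_2^n$ strictly contains it. $1_S$ is the indicator function of $S$; $\gamma_S(a)=1$ if $a\neq0$ and $(a+S)\cap S\neq\emptyset$, else $0$. -}

module Defs where

open import Data.Bool using (Bool; true; false; _xor_; _∧_; _∨_; if_then_else_; T)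
open import Data.Nat using (ℕ; zero; suc; _≥_)
open import Data.Integer using (ℤ; 0ℤ; 1ℤ; _+_; _*_)
open import Data.List using (List; []; _∷_; map; _++_; foldr; length; filter)
open import Data.Vec using (Vec; []; _∷_; zipWith; replicate)
open import Data.Product using (_×_)
open import Data.Sum using (_⊎_)
open import Relation.Binary.PropositionalEquality using (_≡_; _≢_)
open import Relation.Nullary.Decidable using (does)
open import Data.Vec.Properties using (≡-dec)
import Data.Bool.Properties as BP

V : ℕ → Set
V n = Vec Bool n

_⊕_ : ∀ {n} → V n → V n → V n
_⊕_ = zipWith _xor_

𝟎 : ∀ {n} → V n
𝟎 {n} = replicate n false

Subset : ℕ → Set
Subset n = V n → Bool

_∈S_ : ∀ {n} → V n → Subset n → Set
x ∈S S = T (S x)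

_⊆_ : ∀ {n} → Subset n → Subset n → Set
S ⊆ S' = ∀ x → x ∈S S → x ∈S S'

allV : (n : ℕ) → List (V n)
allV zero = [] ∷ []
allV (suc n) = map (false ∷_) (allV n) ++ map (true ∷_) (allV n)

card : ∀ {n} → Subset n → ℕ
card {n} S = length (filter (λ x → BP.T? (S x)) (allV n))

IsSidon : ∀ {n} → Subset n → Set
IsSidon S = ∀ a b c d → a ∈S S → b ∈S S → c ∈S S → d ∈S S →
  a ≢ b → c ≢ d → a ⊕ b ≡ c ⊕ d →
  (a ≡ c × b ≡ d) ⊎ (a ≡ d × b ≡ c)

IsMaximalSidon : ∀ {n} → Subset n → Set
IsMaximalSidon S = IsSidon S × (∀ S' → IsSidon S' → S ⊆ S' → S' ⊆ S)

𝟙 : ∀ {n} → Subset n → V n → ℤ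
𝟙 S x = if S x then 1ℤ else 0ℤ

anyV : ∀ {n} → (V n → Bool) → Bool
anyV {n} f = foldr (λ x b → f x ∨ b) false (allV n)

isZero : ∀ {n} → V n → Bool
isZero x = does (≡-dec BP._≟_ x 𝟎)

γ : ∀ {n} → Subset n → V n → ℤ
γ S a = if isZero a then 0ℤ else (if anyV (λ s → S s ∧ S (a ⊕ s)) then 1ℤ else 0ℤ)

sumV : ∀ {n} → (V n → ℤ) → ℤ
sumV {n} f = foldr (λ x acc → f x + acc) 0ℤ (allV n)

prodV : ∀ {n} → (V n → ℤ) → ℤ
prodV {n} f = foldr (λ x acc → f x * acc) 1ℤ (allV n)

{-# OPTIONS --safe #-}
module Submission where

-- The p-th factor counts the x ∈ S for which x + p is a nonzero element of S + S, so it is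
-- nonzero exactly when p = x + s + t with x, s, t ∈ S and x ≠ p ("p is covered").  Every p ∈ S
-- is covered (take x ∈ S ∖ {p}, s = x, t = p; only |S| ≥ 2 is needed).  For p ∉ S, a
-- relation a + b = c + d in S ∪ {p} not already excluded by S being Sidon involves p
-- exactly once and so covers p; conversely a covering of p is such a relation.  Hence S
-- is maximal iff every p is covered, iff no factor vanishes.

open import Defs
open import Data.Nat using (ℕ; zero; suc; _≥_; z≤n; s≤s)
open import Data.Nat.Properties using (<⇒≤)
open import Data.Integer using (ℤ; 0ℤ; 1ℤ; _+_; _*_; _≤_; _<_; +≤+; +<+)
open import Data.Integer.Properties
  using (≤-refl; +-mono-≤; +-mono-<-≤; +-mono-≤-<; +-identityˡ; *-zeroʳ; <⇒≢; i*j≡0⇒i≡0∨j≡0)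
open import Data.Bool using (Bool; true; false; _∧_; _∨_; if_then_else_; T)
open import Data.Bool.Properties using (_≟_; T?; T-∧; T-∨; xor-assoc; xor-comm; xor-identityˡ; xor-same)
open import Data.Vec using ([]; _∷_)
open import Data.Vec.Properties using (≡-dec; ∷-injectiveʳ; zipWith-assoc; zipWith-comm; zipWith-identityˡ)
open import Data.List using (List; []; _∷_; foldr; map; length)
open import Data.List.Properties using (foldr-map)
open import Data.List.Relation.Unary.Any using (Any; here; there; satisfied)
open import Data.List.Relation.Unary.Any.Properties using (any⇔)
open import Data.List.Relation.Unary.All as All using (All; []; _∷_)
open import Data.List.Relation.Unary.AllPairs using ([]; _∷_)
open import Data.List.Relation.Unary.Unique.Propositional using (Unique)
import Data.List.Relation.Unary.Unique.Propositional.Properties as Unique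
open import Data.List.Membership.Propositional using (_∈_; lose)
open import Data.List.Membership.Propositional.Properties
  using (∈-map⁺; ∈-map⁻; ∈-++⁺ˡ; ∈-++⁺ʳ; ∈-filter⁻)
open import Data.Product using (_×_; ∃; ∃-syntax; _,_; proj₁; proj₂)
open import Data.Sum using (_⊎_; inj₁; inj₂; [_,_]′)
import Data.Sum as Sum
open import Data.Empty using (⊥-elim)
open import Function using (_∘_)
open import Function.Bundles using (_⇔_; mk⇔; Equivalence)
import Function.Properties.Equivalence as ⇔
open import Relation.Nullary using (¬_; yes; no; isYes)
open import Relation.Nullary.Reflects using (Reflects; ofʸ; ofⁿ; T-reflects; fromEquivalence)
open import Relation.Nullary.Decidable using (toWitness; fromWitness)
open import Relation.Binary.Definitions using (DecidableEquality)
open import Relation.Binary.PropositionalEquality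
  using (_≡_; _≢_; refl; sym; trans; cong; cong₂; subst; ≢-sym; module ≡-Reasoning)

open Equivalence using (to; from)

⊕-self : ∀ {n} (x : V n) → x ⊕ x ≡ 𝟎
⊕-self []      = refl
⊕-self (b ∷ x) = cong₂ _∷_ (xor-same b) (⊕-self x)

module _ {n : ℕ} where

  ⊕-assoc : (x y z : V n) → (x ⊕ y) ⊕ z ≡ x ⊕ (y ⊕ z)
  ⊕-assoc = zipWith-assoc xor-assoc

  ⊕-comm : (x y : V n) → x ⊕ y ≡ y ⊕ x
  ⊕-comm = zipWith-comm xor-comm

  ⊕-identityˡ : (x : V n) → 𝟎 ⊕ x ≡ x
  ⊕-identityˡ = zipWith-identityˡ xor-identityˡ

  x⊕[x⊕y]≡y : (x y : V n) → x ⊕ (x ⊕ y) ≡ y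
  x⊕[x⊕y]≡y x y = begin
    x ⊕ (x ⊕ y) ≡⟨ ⊕-assoc x x y ⟨
    (x ⊕ x) ⊕ y ≡⟨ cong (_⊕ y) (⊕-self x) ⟩
    𝟎 ⊕ y       ≡⟨ ⊕-identityˡ y ⟩
    y           ∎
    where open ≡-Reasoning

  x⊕[y⊕x]≡y : (x y : V n) → x ⊕ (y ⊕ x) ≡ y
  x⊕[y⊕x]≡y x y = trans (cong (x ⊕_) (⊕-comm y x)) (x⊕[x⊕y]≡y x y)

  [x⊕y]⊕x≡y : (x y : V n) → (x ⊕ y) ⊕ x ≡ y
  [x⊕y]⊕x≡y x y = trans (⊕-comm (x ⊕ y) x) (x⊕[x⊕y]≡y x y)

  ⊕-cancelˡ : (x : V n) {y z : V n} → x ⊕ y ≡ x ⊕ z → y ≡ z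
  ⊕-cancelˡ x {y} {z} eq = begin
    y           ≡⟨ x⊕[x⊕y]≡y x y ⟨
    x ⊕ (x ⊕ y) ≡⟨ cong (x ⊕_) eq ⟩
    x ⊕ (x ⊕ z) ≡⟨ x⊕[x⊕y]≡y x z ⟩
    z           ∎
    where open ≡-Reasoning

  ⊕-cancelʳ : (x : V n) {y z : V n} → y ⊕ x ≡ z ⊕ x → y ≡ z
  ⊕-cancelʳ x {y} {z} eq = ⊕-cancelˡ x (trans (⊕-comm x y) (trans eq (⊕-comm z x)))

  ⊕≡𝟎⇒≡ : {x y : V n} → x ⊕ y ≡ 𝟎 → x ≡ y
  ⊕≡𝟎⇒≡ {x} eq = ⊕-cancelˡ x (trans (⊕-self x) (sym eq))

  ⊕≢𝟎⇒≢ : {x y : V n} → x ⊕ y ≢ 𝟎 → x ≢ y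
  ⊕≢𝟎⇒≢ x⊕y≢𝟎 refl = x⊕y≢𝟎 (⊕-self _)

_≟ᵥ_ : ∀ {n} → DecidableEquality (V n)
_≟ᵥ_ = ≡-dec _≟_

∈-allV : ∀ {n} (x : V n) → x ∈ allV n
∈-allV {zero}  []          = here refl
∈-allV {suc n} (false ∷ x) = ∈-++⁺ˡ (∈-map⁺ (false ∷_) (∈-allV x))
∈-allV {suc n} (true ∷ x)  = ∈-++⁺ʳ (map (false ∷_) (allV n)) (∈-map⁺ (true ∷_) (∈-allV x))

allV-unique : ∀ n → Unique (allV n)
allV-unique zero    = [] ∷ []
allV-unique (suc n) =
  Unique.++⁺ (Unique.map⁺ ∷-injectiveʳ (allV-unique n))
             (Unique.map⁺ ∷-injectiveʳ (allV-unique n)) disjoint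
  where
  disjoint : ∀ {x} → ¬ (x ∈ map (false ∷_) (allV n) × x ∈ map (true ∷_) (allV n))
  disjoint (x∈₀ , x∈₁) with ∈-map⁻ (false ∷_) x∈₀ | ∈-map⁻ (true ∷_) x∈₁
  ... | _ , _ , refl | _ , _ , ()

module _ {n : ℕ} {P : V n → Set} where

  Any-allV⇔∃ : Any P (allV n) ⇔ ∃ P
  Any-allV⇔∃ = mk⇔ satisfied (λ (x , px) → lose (∈-allV x) px)

  All-allV⇔∀ : All P (allV n) ⇔ (∀ x → P x)
  All-allV⇔∀ = mk⇔ (λ all x → All.lookup all (∈-allV x)) (λ p → All.tabulate (λ {x} _ → p x))

T-anyV⇔ : ∀ {n} (f : V n → Bool) → T (anyV f) ⇔ (∃[ x ] T (f x))
T-anyV⇔ {n} f =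
  subst (λ b → T b ⇔ (∃[ x ] T (f x))) (foldr-map _∨_ f false (allV n))
        (⇔.trans (⇔.sym any⇔) Any-allV⇔∃)

module _ {A : Set} (_≟ᴬ_ : DecidableEquality A) where

  ∃∈≢ : {xs : List A} → Unique xs → length xs ≥ 2 → ∀ y → ∃[ x ] x ∈ xs × x ≢ y
  ∃∈≢ {x ∷ x′ ∷ _} ((x≢x′ ∷ _) ∷ _) _ y with x ≟ᴬ y
  ... | no x≢y   = x , here refl , x≢y
  ... | yes refl = x′ , there (here refl) , ≢-sym x≢x′
  ∃∈≢ {_ ∷ []} _ (s≤s ())

∃∈S-≢ : ∀ {n} {S : Subset n} → card S ≥ 2 → ∀ p → ∃[ x ] x ∈S S × x ≢ p
∃∈S-≢ {n} {S} 2≤|S| p =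
  let x , x∈ , x≢p = ∃∈≢ _≟ᵥ_ (Unique.filter⁺ (T? ∘ S) (allV-unique n)) 2≤|S| p
  in  x , proj₂ (∈-filter⁻ (T? ∘ S) {xs = allV n} x∈) , x≢p

data IndicatorOf (P : Set) : ℤ → Set where
  holds : P → IndicatorOf P 1ℤ
  fails : ¬ P → IndicatorOf P 0ℤ

module _ {P : Set} where

  reflects⇒indicatorOf : ∀ {b} → Reflects P b → IndicatorOf P (if b then 1ℤ else 0ℤ)
  reflects⇒indicatorOf (ofʸ p)  = holds p
  reflects⇒indicatorOf (ofⁿ ¬p) = fails ¬p

  indicatorOf-nonNeg : ∀ {i} → IndicatorOf P i → 0ℤ ≤ i
  indicatorOf-nonNeg (holds _) = +≤+ z≤n
  indicatorOf-nonNeg (fails _) = ≤-refl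

  indicatorOf-pos : ∀ {i} → IndicatorOf P i → P → 0ℤ < i
  indicatorOf-pos (holds _)  _ = +<+ (s≤s z≤n)
  indicatorOf-pos (fails ¬p) p = ⊥-elim (¬p p)

  *-indicatorOf : ∀ {Q i j} → IndicatorOf P i → IndicatorOf Q j → IndicatorOf (P × Q) (i * j)
  *-indicatorOf (holds p)  (holds q)  = holds (p , q)
  *-indicatorOf (holds _)  (fails ¬q) = fails (¬q ∘ proj₂)
  *-indicatorOf (fails ¬p) _          = fails (¬p ∘ proj₁)

sumL : {A : Set} → (A → ℤ) → List A → ℤ
sumL f = foldr (λ x acc → f x + acc) 0ℤ

prodL : {A : Set} → (A → ℤ) → List A → ℤ
prodL f = foldr (λ x acc → f x * acc) 1ℤ

module _ {A : Set} {P : A → Set} {f : A → ℤ} (f-indicator : ∀ x → IndicatorOf (P x) (f x)) where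

  sumL-nonNeg : ∀ xs → 0ℤ ≤ sumL f xs
  sumL-nonNeg []       = ≤-refl
  sumL-nonNeg (x ∷ xs) = +-mono-≤ (indicatorOf-nonNeg (f-indicator x)) (sumL-nonNeg xs)

  sumL-pos : ∀ {xs} → Any P xs → 0ℤ < sumL f xs
  sumL-pos {x ∷ xs} (here px)   = +-mono-<-≤ (indicatorOf-pos (f-indicator x) px) (sumL-nonNeg xs)
  sumL-pos {x ∷ xs} (there pxs) = +-mono-≤-< (indicatorOf-nonNeg (f-indicator x)) (sumL-pos pxs)

  sumL≢0⇒Any : ∀ xs → sumL f xs ≢ 0ℤ → Any P xs
  sumL≢0⇒Any []       ne = ⊥-elim (ne refl)
  sumL≢0⇒Any (x ∷ xs) ne with f x | f-indicator x
  ... | _ | holds px = here px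
  ... | _ | fails _  = there (sumL≢0⇒Any xs (ne ∘ trans (+-identityˡ (sumL f xs))))

sumV≢0⇔∃ : ∀ {n} {P : V n → Set} {f : V n → ℤ} →
           (∀ x → IndicatorOf (P x) (f x)) → sumV f ≢ 0ℤ ⇔ ∃ P
sumV≢0⇔∃ {n} f-indicator = ⇔.trans
  (mk⇔ (sumL≢0⇒Any f-indicator (allV n)) (≢-sym ∘ <⇒≢ ∘ sumL-pos f-indicator))
  Any-allV⇔∃

module _ {A : Set} (f : A → ℤ) where

  prodL≢0⇒All : ∀ xs → prodL f xs ≢ 0ℤ → All (λ x → f x ≢ 0ℤ) xs
  prodL≢0⇒All []       _  = []
  prodL≢0⇒All (x ∷ xs) ne =
    (λ fx≡0 → ne (cong (_* prodL f xs) fx≡0)) ∷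
    prodL≢0⇒All xs (λ rest≡0 → ne (trans (cong (f x *_) rest≡0) (*-zeroʳ (f x))))

  All⇒prodL≢0 : ∀ {xs} → All (λ x → f x ≢ 0ℤ) xs → prodL f xs ≢ 0ℤ
  All⇒prodL≢0 []             ()
  All⇒prodL≢0 (fx≢0 ∷ rest≢0) eq = [ fx≢0 , All⇒prodL≢0 rest≢0 ]′ (i*j≡0⇒i≡0∨j≡0 _ eq)

prodV≢0⇔∀ : ∀ {n} (f : V n → ℤ) → prodV f ≢ 0ℤ ⇔ (∀ x → f x ≢ 0ℤ)
prodV≢0⇔∀ {n} f = ⇔.trans (mk⇔ (prodL≢0⇒All f (allV n)) (All⇒prodL≢0 f)) All-allV⇔∀

InSumset : ∀ {n} → Subset n → V n → Set
InSumset S a = ∃[ s ] ∃[ t ] s ∈S S × t ∈S S × a ≡ s ⊕ t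

T-anyV⇔InSumset : ∀ {n} (S : Subset n) a → T (anyV (λ s → S s ∧ S (a ⊕ s))) ⇔ InSumset S a
T-anyV⇔InSumset S a = ⇔.trans (T-anyV⇔ _) (mk⇔ sound complete)
  where
  sound : ∃[ s ] T (S s ∧ S (a ⊕ s)) → InSumset S a
  sound (s , s∧a⊕s) =
    let s∈S , a⊕s∈S = to T-∧ s∧a⊕s in s , a ⊕ s , s∈S , a⊕s∈S , sym (x⊕[y⊕x]≡y s a)

  complete : InSumset S a → ∃[ s ] T (S s ∧ S (a ⊕ s))
  complete (s , t , s∈S , t∈S , refl) =
    s , from T-∧ (s∈S , subst (_∈S S) (sym ([x⊕y]⊕x≡y s t)) t∈S)

𝟙-indicatorOf : ∀ {n} (S : Subset n) x → IndicatorOf (x ∈S S) (𝟙 S x)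
𝟙-indicatorOf S x = reflects⇒indicatorOf (T-reflects (S x))

γ-indicatorOf : ∀ {n} (S : Subset n) a → IndicatorOf (a ≢ 𝟎 × InSumset S a) (γ S a)
γ-indicatorOf S a with a ≟ᵥ 𝟎
... | yes a≡𝟎 = fails (λ (a≢𝟎 , _) → a≢𝟎 a≡𝟎)
... | no  a≢𝟎 = reflects⇒indicatorOf
  (fromEquivalence ((a≢𝟎 ,_) ∘ to (T-anyV⇔InSumset S a)) (from (T-anyV⇔InSumset S a) ∘ proj₂))

Covered : ∀ {n} → Subset n → V n → Set
Covered S p = ∃[ x ] x ∈S S × (x ⊕ p ≢ 𝟎 × InSumset S (x ⊕ p))

covered⇔sum≢0 : ∀ {n} (S : Subset n) p → Covered S p ⇔ sumV (λ x → 𝟙 S x * γ S (x ⊕ p)) ≢ 0ℤ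
covered⇔sum≢0 S p =
  ⇔.sym (sumV≢0⇔∃ (λ x → *-indicatorOf (𝟙-indicatorOf S x) (γ-indicatorOf S (x ⊕ p))))

insert : ∀ {n} → V n → Subset n → Subset n
insert p S y = S y ∨ isYes (y ≟ᵥ p)

module _ {n : ℕ} {S : Subset n} where

  ∈-insert⁻ : ∀ {p y} → y ∈S insert p S → y ∈S S ⊎ y ≡ p
  ∈-insert⁻ {p} {y} = Sum.map₂ (toWitness {a? = y ≟ᵥ p}) ∘ to (T-∨ {S y})

  S⊆insert : ∀ {p} → S ⊆ insert p S
  S⊆insert y = from (T-∨ {S y}) ∘ inj₁

  p∈insert : ∀ {p} → p ∈S insert p S
  p∈insert {p} = from (T-∨ {S p}) (inj₂ (fromWitness refl))

  ∈⇒covered : card S ≥ 2 → ∀ {p} → p ∈S S → Covered S p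
  ∈⇒covered 2≤|S| {p} p∈S =
    let x , x∈S , x≢p = ∃∈S-≢ 2≤|S| p
    in  x , x∈S , x≢p ∘ ⊕≡𝟎⇒≡ , x , p , x∈S , p∈S , refl

  relation⇒covered : ∀ {p b c d} → ¬ p ∈S S → b ∈S S → c ∈S S → d ∈S S →
                     p ⊕ b ≡ c ⊕ d → Covered S p
  relation⇒covered {p} {b} p∉S b∈S c∈S d∈S eq =
    b , b∈S , (λ b⊕p≡𝟎 → p∉S (subst (_∈S S) (⊕≡𝟎⇒≡ b⊕p≡𝟎) b∈S)) ,
    _ , _ , c∈S , d∈S , trans (⊕-comm b p) eq

  insert-isSidon : ∀ {p} → IsSidon S → ¬ p ∈S S → ¬ Covered S p → IsSidon (insert p S)
  insert-isSidon sidon p∉S ¬covered a b c d a∈ b∈ c∈ d∈ a≢b c≢d eq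
    with ∈-insert⁻ a∈ | ∈-insert⁻ b∈ | ∈-insert⁻ c∈ | ∈-insert⁻ d∈
  ... | inj₁ a∈S | inj₁ b∈S | inj₁ c∈S | inj₁ d∈S = sidon a b c d a∈S b∈S c∈S d∈S a≢b c≢d eq
  ... | inj₂ refl | inj₂ refl | _ | _ = ⊥-elim (a≢b refl)
  ... | _ | _ | inj₂ refl | inj₂ refl = ⊥-elim (c≢d refl)
  ... | inj₂ refl | _ | inj₂ refl | _ = inj₁ (refl , ⊕-cancelˡ a eq)
  ... | inj₂ refl | _ | _ | inj₂ refl = inj₂ (refl , ⊕-cancelˡ a (trans eq (⊕-comm c a)))
  ... | _ | inj₂ refl | inj₂ refl | _ = inj₂ (⊕-cancelʳ b (trans eq (⊕-comm b d)) , refl)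
  ... | _ | inj₂ refl | _ | inj₂ refl = inj₁ (⊕-cancelʳ b eq , refl)
  ... | inj₂ refl | inj₁ b∈S | inj₁ c∈S | inj₁ d∈S =
    ⊥-elim (¬covered (relation⇒covered p∉S b∈S c∈S d∈S eq))
  ... | inj₁ a∈S | inj₂ refl | inj₁ c∈S | inj₁ d∈S =
    ⊥-elim (¬covered (relation⇒covered p∉S a∈S c∈S d∈S (trans (⊕-comm b a) eq)))
  ... | inj₁ a∈S | inj₁ b∈S | inj₂ refl | inj₁ d∈S =
    ⊥-elim (¬covered (relation⇒covered p∉S d∈S a∈S b∈S (sym eq)))
  ... | inj₁ a∈S | inj₁ b∈S | inj₁ c∈S | inj₂ refl =
    ⊥-elim (¬covered (relation⇒covered p∉S c∈S a∈S b∈S (trans (⊕-comm d c) (sym eq))))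

  covered⇒∈ : ∀ {S′ p} → IsSidon S′ → S ⊆ S′ → p ∈S S′ → Covered S p → p ∈S S
  covered⇒∈ {p = p} sidon′ S⊆S′ p∈S′ (x , x∈S , x⊕p≢𝟎 , s , t , s∈S , t∈S , x⊕p≡s⊕t)
    with sidon′ p x s t p∈S′ (S⊆S′ x x∈S) (S⊆S′ s s∈S) (S⊆S′ t t∈S)
                (≢-sym (⊕≢𝟎⇒≢ x⊕p≢𝟎)) (⊕≢𝟎⇒≢ (x⊕p≢𝟎 ∘ trans x⊕p≡s⊕t))
                (trans (⊕-comm p x) x⊕p≡s⊕t)
  ... | inj₁ (refl , _) = s∈S
  ... | inj₂ (refl , _) = t∈S

  covered⇒maximal : IsSidon S → (∀ p → Covered S p) → IsMaximalSidon S
  covered⇒maximal sidon covered =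
    sidon , λ S′ sidon′ S⊆S′ p p∈S′ → covered⇒∈ sidon′ S⊆S′ p∈S′ (covered p)

  -- Only ¬¬, as Covered S p is not decided here; this suffices because non-vanishing of a
  -- factor is itself a negation.
  maximal⇒¬¬covered : card S ≥ 2 → IsMaximalSidon S → ∀ p → ¬ ¬ Covered S p
  maximal⇒¬¬covered 2≤|S| (sidon , maximal) p ¬covered with T? (S p)
  ... | yes p∈S = ¬covered (∈⇒covered 2≤|S| p∈S)
  ... | no  p∉S =
    p∉S (maximal (insert p S) (insert-isSidon sidon p∉S ¬covered) S⊆insert p p∈insert)

proposition4p7 : (n : ℕ) (S : Subset n) → IsSidon S → card S ≥ 3 →
    (IsMaximalSidon S ⇔ (prodV (λ p → sumV (λ x → 𝟙 S x * γ S (x ⊕ p))) ≢ 0ℤ))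
proposition4p7 n S sidon 3≤|S| = mk⇔
  (λ maximal → from (prodV≢0⇔∀ factor) λ p factor≡0 →
     maximal⇒¬¬covered 2≤|S| maximal p (λ covered → to (covered⇔sum≢0 S p) covered factor≡0))
  (λ prod≢0 → covered⇒maximal sidon λ p → from (covered⇔sum≢0 S p) (to (prodV≢0⇔∀ factor) prod≢0 p))
  where
  factor : V n → ℤ
  factor p = sumV (λ x → 𝟙 S x * γ S (x ⊕ p))

  2≤|S| : card S ≥ 2
  2≤|S| = <⇒≤ 3≤|S|
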